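{- Let $p,q\in\mathbb{Z}$ be such that $x^3-px-q$ is irreducible over $\mathbb{Q}$ with exactly one real root $\theta$, and let $K=\mathbb{Q}(\theta)$. If $\zeta=x+y\theta+z\theta^2\in K^\times$ with $x,y,z\in\mathbb{Q}$, then $$\bigl(2(x+pz)-y\theta-z\theta^2\bigr)^2+(3\theta^2-4p)(y-z\theta)^2=\frac{4N(\zeta)}{\zeta}$$ and $$(x+pz-y\theta)^2+(x+pz-z\theta^2)^2+\Bigl(1-\frac{2p}{\theta^2}\Bigr)(y\theta-z\theta^2)^2=\frac{2N(\zeta)}{\zeta}.$$
   Context: $N(\zeta)=N_{K/\mathbb{Q}}(\zeta)$ denotes the field norm from $K$ to $\mathbb{Q}$. -}

module Defs where

open import Data.Integer as ℤ using (ℤ)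
open import Data.Rational as ℚ using (ℚ; _+_; _*_; _-_; 0ℚ; 1ℚ)
open import Data.Product using (Σ; ∃; _×_; _,_)
open import Relation.Binary.PropositionalEquality using (_≡_)
open import Relation.Nullary using (¬_)

ι : ℤ → ℚ
ι n = n ℚ./ 1

-- The cubic f(x) = x³ − p x − q over ℚ is reducible iff it factors as a
-- product of a polynomial of degree ≤ 1 and one of degree ≤ 2 over ℚ
-- (for a cubic, any factorisation into non-units has this shape; conversely
-- any such product equal to f forces both factors to have exact degrees 1, 2).
-- (a0 + a1 x)(b0 + b1 x + b2 x²) = -q - p x + 0 x² + 1 x³ , coefficientwise.
Reducible : ℤ → ℤ → Set
Reducible p q =
  Σ ℚ λ a0 → Σ ℚ λ a1 → Σ ℚ λ b0 → Σ ℚ λ b1 → Σ ℚ λ b2 →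
      (a0 * b0 ≡ ℚ.- ι q)
    × (a0 * b1 + a1 * b0 ≡ ℚ.- ι p)
    × (a0 * b2 + a1 * b1 ≡ 0ℚ)
    × (a1 * b2 ≡ 1ℚ)

Irreducible : ℤ → ℤ → Set
Irreducible p q = ¬ Reducible p q

-- x³ − p x − q has exactly one real root (given it is irreducible, hence
-- separable) iff its discriminant 4p³ − 27q² is negative.
OneRealRoot : ℤ → ℤ → Set
OneRealRoot p q = (ℤ.+ 4) ℤ.* (p ℤ.* p ℤ.* p) ℤ.< (ℤ.+ 27) ℤ.* (q ℤ.* q)

-- The field K = ℚ(θ) ≅ ℚ[X]/(X³ − pX − q), elements x + yθ + zθ² written
-- as triples (x , y , z) in the basis 1, θ, θ².
record K : Set where
  constructor ⟨_,_,_⟩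
  field
    c0 c1 c2 : ℚ

module Field (p q : ℤ) where
  P Q : ℚ
  P = ι p
  Q = ι q

  infixl 6 _⊕_ _⊖_
  infixl 7 _⊗_

  _⊕_ : K → K → K
  ⟨ a0 , a1 , a2 ⟩ ⊕ ⟨ b0 , b1 , b2 ⟩ = ⟨ a0 + b0 , a1 + b1 , a2 + b2 ⟩

  _⊖_ : K → K → K
  ⟨ a0 , a1 , a2 ⟩ ⊖ ⟨ b0 , b1 , b2 ⟩ = ⟨ a0 - b0 , a1 - b1 , a2 - b2 ⟩

  -- multiplication using θ³ = pθ + q and θ⁴ = pθ² + qθ
  _⊗_ : K → K → K
  ⟨ a0 , a1 , a2 ⟩ ⊗ ⟨ b0 , b1 , b2 ⟩ =
    let d0 = a0 * b0
        d1 = a0 * b1 + a1 * b0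
        d2 = a0 * b2 + a1 * b1 + a2 * b0
        d3 = a1 * b2 + a2 * b1
        d4 = a2 * b2
    in ⟨ d0 + Q * d3 , d1 + P * d3 + Q * d4 , d2 + P * d4 ⟩

  emb : ℚ → K
  emb r = ⟨ r , 0ℚ , 0ℚ ⟩

  0K 1K θ : K
  0K = emb 0ℚ
  1K = emb 1ℚ
  θ  = ⟨ 0ℚ , 1ℚ , 0ℚ ⟩

  elt : ℚ → ℚ → ℚ → K
  elt x y z = ⟨ x , y , z ⟩

  det3 : ℚ → ℚ → ℚ → ℚ → ℚ → ℚ → ℚ → ℚ → ℚ → ℚ
  det3 a0 a1 a2 b0 b1 b2 c0 c1 c2 =
      a0 * (b1 * c2 - b2 * c1)
    - b0 * (a1 * c2 - a2 * c1)
    + c0 * (a1 * b2 - a2 * b1)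

  -- field norm N_{K/ℚ}(ζ) = det of multiplication by ζ in the basis 1, θ, θ²
  N : K → ℚ
  N ζ with ζ ⊗ 1K | ζ ⊗ θ | ζ ⊗ (θ ⊗ θ)
  ... | ⟨ a0 , a1 , a2 ⟩ | ⟨ b0 , b1 , b2 ⟩ | ⟨ c0 , c1 , c2 ⟩ =
    det3 a0 a1 a2 b0 b1 b2 c0 c1 c2

  sq : K → K
  sq a = a ⊗ a

-- In the basis 1, θ, θ² of K, each identity E = c N(ζ) / ζ is equivalent to
-- E ζ = c N(ζ), whose coordinates are polynomial identities in x, y, z, p, q
-- (using θ³ = pθ + q). In the second identity θ⁻¹ enters only through
-- (1 − 2p θ⁻²)(yθ − zθ²)² = (yθ − zθ²)² − 2p (θθ⁻¹)² (y − zθ)², so after replacing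
-- θθ⁻¹ by 1 it is polynomial as well.
module Submission where

open import Defs
open import Data.Integer as ℤ using (ℤ)
open import Data.Rational using (ℚ; _+_; _*_; 0ℚ; 1ℚ)
open import Data.Rational.Properties using (_≟_; +-*-commutativeRing)
open import Data.Fin using (#_)
open import Data.Nat as ℕ using (ℕ)
open import Data.Product using (_×_; _,_)
open import Data.Vec using (Vec; []; _∷_)
open import Level using (0ℓ)
open import Relation.Binary.PropositionalEquality using (_≡_; refl; cong; module ≡-Reasoning)
open import Relation.Nullary using (¬_)
open import Relation.Nullary.Decidable using (dec⇒maybe)
open import Tactic.RingSolver.Core.AlmostCommutativeRing using (AlmostCommutativeRing; fromCommutativeRing)

ℚ-almostCommutativeRing : AlmostCommutativeRing 0ℓ 0ℓ
ℚ-almostCommutativeRing = fromCommutativeRing +-*-commutativeRing (λ r → dec⇒maybe (0ℚ ≟ r))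

open import Tactic.RingSolver.NonReflective ℚ-almostCommutativeRing
  using (Expr; Κ; Ι; ⊝_; module Ops)
  renaming (_⊕_ to _+ᴱ_; _⊗_ to _*ᴱ_)
open Ops using (⟦_⟧; ⟦_⇓⟧; prove)

record Kᴱ (n : ℕ) : Set where
  constructor ⟪_,_,_⟫
  field
    c0 c1 c2 : Expr ℚ n

⟦_⟧ᴷ : ∀ {n} → Kᴱ n → Vec ℚ n → K
⟦ ⟪ a0 , a1 , a2 ⟫ ⟧ᴷ ρ = ⟨ ⟦ a0 ⟧ ρ , ⟦ a1 ⟧ ρ , ⟦ a2 ⟧ ρ ⟩

⟨,,⟩-cong : ∀ {a0 a1 a2 b0 b1 b2 : ℚ} → a0 ≡ b0 → a1 ≡ b1 → a2 ≡ b2 →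
            ⟨ a0 , a1 , a2 ⟩ ≡ ⟨ b0 , b1 , b2 ⟩
⟨,,⟩-cong refl refl refl = refl

K-prove : ∀ {n} (ρ : Vec ℚ n) (a b : Kᴱ n) →
          ⟦ Kᴱ.c0 a ⇓⟧ ρ ≡ ⟦ Kᴱ.c0 b ⇓⟧ ρ →
          ⟦ Kᴱ.c1 a ⇓⟧ ρ ≡ ⟦ Kᴱ.c1 b ⇓⟧ ρ →
          ⟦ Kᴱ.c2 a ⇓⟧ ρ ≡ ⟦ Kᴱ.c2 b ⇓⟧ ρ →
          ⟦ a ⟧ᴷ ρ ≡ ⟦ b ⟧ᴷ ρ
K-prove ρ ⟪ a0 , a1 , a2 ⟫ ⟪ b0 , b1 , b2 ⟫ e0 e1 e2 =
  ⟨,,⟩-cong (prove ρ a0 b0 e0) (prove ρ a1 b1 e1) (prove ρ a2 b2 e2)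

-- A copy of Field p q on ring-solver expressions, so that ⟦_⟧ᴷ of a quoted term is
-- definitionally the corresponding element of K. Variables 0 and 1 stand for p and q.
module Quoted {m : ℕ} where
  infixl 6 _-ᴱ_ _⊕ᴱ_ _⊖ᴱ_
  infixl 7 _⊗ᴱ_

  E : Set
  E = Expr ℚ (2 ℕ.+ m)

  Pᴱ Qᴱ : E
  Pᴱ = Ι (# 0)
  Qᴱ = Ι (# 1)

  _-ᴱ_ : E → E → E
  a -ᴱ b = a +ᴱ ⊝ b

  _⊕ᴱ_ _⊖ᴱ_ _⊗ᴱ_ : Kᴱ (2 ℕ.+ m) → Kᴱ (2 ℕ.+ m) → Kᴱ (2 ℕ.+ m)
  ⟪ a0 , a1 , a2 ⟫ ⊕ᴱ ⟪ b0 , b1 , b2 ⟫ = ⟪ a0 +ᴱ b0 , a1 +ᴱ b1 , a2 +ᴱ b2 ⟫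
  ⟪ a0 , a1 , a2 ⟫ ⊖ᴱ ⟪ b0 , b1 , b2 ⟫ = ⟪ a0 -ᴱ b0 , a1 -ᴱ b1 , a2 -ᴱ b2 ⟫
  ⟪ a0 , a1 , a2 ⟫ ⊗ᴱ ⟪ b0 , b1 , b2 ⟫ =
    let d0 = a0 *ᴱ b0
        d1 = a0 *ᴱ b1 +ᴱ a1 *ᴱ b0
        d2 = a0 *ᴱ b2 +ᴱ a1 *ᴱ b1 +ᴱ a2 *ᴱ b0
        d3 = a1 *ᴱ b2 +ᴱ a2 *ᴱ b1
        d4 = a2 *ᴱ b2
    in ⟪ d0 +ᴱ Qᴱ *ᴱ d3 , d1 +ᴱ Pᴱ *ᴱ d3 +ᴱ Qᴱ *ᴱ d4 , d2 +ᴱ Pᴱ *ᴱ d4 ⟫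

  embᴱ : E → Kᴱ (2 ℕ.+ m)
  embᴱ r = ⟪ r , Κ 0ℚ , Κ 0ℚ ⟫

  1Kᴱ θᴱ : Kᴱ (2 ℕ.+ m)
  1Kᴱ = embᴱ (Κ 1ℚ)
  θᴱ  = ⟪ Κ 0ℚ , Κ 1ℚ , Κ 0ℚ ⟫

  sqᴱ : Kᴱ (2 ℕ.+ m) → Kᴱ (2 ℕ.+ m)
  sqᴱ a = a ⊗ᴱ a

  det3ᴱ : E → E → E → E → E → E → E → E → E → E
  det3ᴱ a0 a1 a2 b0 b1 b2 c0 c1 c2 =
      a0 *ᴱ (b1 *ᴱ c2 -ᴱ b2 *ᴱ c1)
    -ᴱ b0 *ᴱ (a1 *ᴱ c2 -ᴱ a2 *ᴱ c1)
    +ᴱ c0 *ᴱ (a1 *ᴱ b2 -ᴱ a2 *ᴱ b1)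

  Nᴱ : Kᴱ (2 ℕ.+ m) → E
  Nᴱ ζ with ζ ⊗ᴱ 1Kᴱ | ζ ⊗ᴱ θᴱ | ζ ⊗ᴱ (θᴱ ⊗ᴱ θᴱ)
  ... | ⟪ a0 , a1 , a2 ⟫ | ⟪ b0 , b1 , b2 ⟫ | ⟪ c0 , c1 , c2 ⟫ =
    det3ᴱ a0 a1 a2 b0 b1 b2 c0 c1 c2

  form₁ᴱ : E → E → E → Kᴱ (2 ℕ.+ m)
  form₁ᴱ x y z =
    sqᴱ (embᴱ (Κ (ι (ℤ.+ 2))) ⊗ᴱ embᴱ (x +ᴱ Pᴱ *ᴱ z) ⊖ᴱ embᴱ y ⊗ᴱ θᴱ ⊖ᴱ embᴱ z ⊗ᴱ sqᴱ θᴱ)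
      ⊕ᴱ (embᴱ (Κ (ι (ℤ.+ 3))) ⊗ᴱ sqᴱ θᴱ ⊖ᴱ embᴱ (Κ (ι (ℤ.+ 4)) *ᴱ Pᴱ)) ⊗ᴱ sqᴱ (embᴱ y ⊖ᴱ embᴱ z ⊗ᴱ θᴱ)

  form₂ᴱ : E → E → E → Kᴱ (2 ℕ.+ m) → Kᴱ (2 ℕ.+ m)
  form₂ᴱ x y z u =
    sqᴱ (embᴱ (x +ᴱ Pᴱ *ᴱ z) ⊖ᴱ embᴱ y ⊗ᴱ θᴱ)
      ⊕ᴱ sqᴱ (embᴱ (x +ᴱ Pᴱ *ᴱ z) ⊖ᴱ embᴱ z ⊗ᴱ sqᴱ θᴱ)
      ⊕ᴱ (1Kᴱ ⊖ᴱ embᴱ (Κ (ι (ℤ.+ 2)) *ᴱ Pᴱ) ⊗ᴱ sqᴱ u) ⊗ᴱ sqᴱ (embᴱ y ⊗ᴱ θᴱ ⊖ᴱ embᴱ z ⊗ᴱ sqᴱ θᴱ)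

  form₂′ᴱ : E → E → E → Kᴱ (2 ℕ.+ m) → Kᴱ (2 ℕ.+ m)
  form₂′ᴱ x y z w =
    sqᴱ (embᴱ (x +ᴱ Pᴱ *ᴱ z) ⊖ᴱ embᴱ y ⊗ᴱ θᴱ)
      ⊕ᴱ sqᴱ (embᴱ (x +ᴱ Pᴱ *ᴱ z) ⊖ᴱ embᴱ z ⊗ᴱ sqᴱ θᴱ)
      ⊕ᴱ (sqᴱ (embᴱ y ⊗ᴱ θᴱ ⊖ᴱ embᴱ z ⊗ᴱ sqᴱ θᴱ)
           ⊖ᴱ embᴱ (Κ (ι (ℤ.+ 2)) *ᴱ Pᴱ) ⊗ᴱ sqᴱ w ⊗ᴱ sqᴱ (embᴱ y ⊖ᴱ embᴱ z ⊗ᴱ θᴱ))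

open Quoted

xᴱ yᴱ zᴱ : ∀ {m} → Expr ℚ (5 ℕ.+ m)
xᴱ = Ι (# 2)
yᴱ = Ι (# 3)
zᴱ = Ι (# 4)

ζᴱ : ∀ {m} → Kᴱ (5 ℕ.+ m)
ζᴱ = ⟪ xᴱ , yᴱ , zᴱ ⟫

module Arithmetic (p q : ℤ) where
  open Field p q

  ⊗-assoc : ∀ a b c → (a ⊗ b) ⊗ c ≡ a ⊗ (b ⊗ c)
  ⊗-assoc ⟨ a0 , a1 , a2 ⟩ ⟨ b0 , b1 , b2 ⟩ ⟨ c0 , c1 , c2 ⟩ =
    K-prove (P ∷ Q ∷ a0 ∷ a1 ∷ a2 ∷ b0 ∷ b1 ∷ b2 ∷ c0 ∷ c1 ∷ c2 ∷ [])
      ((A ⊗ᴱ B) ⊗ᴱ C) (A ⊗ᴱ (B ⊗ᴱ C)) refl refl refl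
    where
    A B C : Kᴱ 11
    A = ⟪ Ι (# 2) , Ι (# 3) , Ι (# 4) ⟫
    B = ⟪ Ι (# 5) , Ι (# 6) , Ι (# 7) ⟫
    C = ⟪ Ι (# 8) , Ι (# 9) , Ι (# 10) ⟫

  ⊗-identityʳ : ∀ a → a ⊗ 1K ≡ a
  ⊗-identityʳ ⟨ a0 , a1 , a2 ⟩ =
    K-prove (P ∷ Q ∷ a0 ∷ a1 ∷ a2 ∷ []) (ζᴱ ⊗ᴱ 1Kᴱ) ζᴱ refl refl refl

  x⊗y≡z⇒x≡z⊗y⁻¹ : ∀ {a b c b⁻¹} → a ⊗ b ≡ c → b ⊗ b⁻¹ ≡ 1K → a ≡ c ⊗ b⁻¹
  x⊗y≡z⇒x≡z⊗y⁻¹ {a} {b} {c} {b⁻¹} a⊗b≡c b⊗b⁻¹≡1 = begin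
    a                ≡⟨ ⊗-identityʳ a ⟨
    a ⊗ 1K           ≡⟨ cong (a ⊗_) b⊗b⁻¹≡1 ⟨
    a ⊗ (b ⊗ b⁻¹)    ≡⟨ ⊗-assoc a b b⁻¹ ⟨
    (a ⊗ b) ⊗ b⁻¹    ≡⟨ cong (_⊗ b⁻¹) a⊗b≡c ⟩
    c ⊗ b⁻¹          ∎
    where open ≡-Reasoning

  form₁ : ℚ → ℚ → ℚ → K
  form₁ x y z =
    sq (emb (ι (ℤ.+ 2)) ⊗ emb (x + P * z) ⊖ emb y ⊗ θ ⊖ emb z ⊗ sq θ)
      ⊕ (emb (ι (ℤ.+ 3)) ⊗ sq θ ⊖ emb (ι (ℤ.+ 4) * P)) ⊗ sq (emb y ⊖ emb z ⊗ θ)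

  form₂ : ℚ → ℚ → ℚ → K → K
  form₂ x y z u =
    sq (emb (x + P * z) ⊖ emb y ⊗ θ)
      ⊕ sq (emb (x + P * z) ⊖ emb z ⊗ sq θ)
      ⊕ (1K ⊖ emb (ι (ℤ.+ 2) * P) ⊗ sq u) ⊗ sq (emb y ⊗ θ ⊖ emb z ⊗ sq θ)

  form₂′ : ℚ → ℚ → ℚ → K → K
  form₂′ x y z w =
    sq (emb (x + P * z) ⊖ emb y ⊗ θ)
      ⊕ sq (emb (x + P * z) ⊖ emb z ⊗ sq θ)
      ⊕ (sq (emb y ⊗ θ ⊖ emb z ⊗ sq θ)
           ⊖ emb (ι (ℤ.+ 2) * P) ⊗ sq w ⊗ sq (emb y ⊖ emb z ⊗ θ))

  form₁⊗ζ≡4N : ∀ x y z → form₁ x y z ⊗ elt x y z ≡ emb (ι (ℤ.+ 4) * N (elt x y z))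
  form₁⊗ζ≡4N x y z =
    K-prove (P ∷ Q ∷ x ∷ y ∷ z ∷ [])
      (form₁ᴱ xᴱ yᴱ zᴱ ⊗ᴱ ζᴱ) (embᴱ (Κ (ι (ℤ.+ 4)) *ᴱ Nᴱ ζᴱ)) refl refl refl

  form₂′[1]⊗ζ≡2N : ∀ x y z → form₂′ x y z 1K ⊗ elt x y z ≡ emb (ι (ℤ.+ 2) * N (elt x y z))
  form₂′[1]⊗ζ≡2N x y z =
    K-prove (P ∷ Q ∷ x ∷ y ∷ z ∷ [])
      (form₂′ᴱ xᴱ yᴱ zᴱ 1Kᴱ ⊗ᴱ ζᴱ) (embᴱ (Κ (ι (ℤ.+ 2)) *ᴱ Nᴱ ζᴱ)) refl refl refl

  form₂≡form₂′[θ⊗u] : ∀ x y z u → form₂ x y z u ≡ form₂′ x y z (θ ⊗ u)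
  form₂≡form₂′[θ⊗u] x y z ⟨ u0 , u1 , u2 ⟩ =
    K-prove (P ∷ Q ∷ x ∷ y ∷ z ∷ u0 ∷ u1 ∷ u2 ∷ [])
      (form₂ᴱ xᴱ yᴱ zᴱ uᴱ) (form₂′ᴱ xᴱ yᴱ zᴱ (θᴱ ⊗ᴱ uᴱ)) refl refl refl
    where
    uᴱ : Kᴱ 8
    uᴱ = ⟪ Ι (# 5) , Ι (# 6) , Ι (# 7) ⟫

mainTheorem5 : (p q : ℤ) → Irreducible p q → OneRealRoot p q →
    let open Field p q in
    (x y z : ℚ) → ¬ (elt x y z ≡ 0K) →
    (ζinv : K) → elt x y z ⊗ ζinv ≡ 1K →
    (θinv : K) → θ ⊗ θinv ≡ 1K →
      (sq (emb (ι (ℤ.+ 2)) ⊗ emb (x + P * z) ⊖ emb y ⊗ θ ⊖ emb z ⊗ sq θ)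
        ⊕ (emb (ι (ℤ.+ 3)) ⊗ sq θ ⊖ emb (ι (ℤ.+ 4) * P)) ⊗ sq (emb y ⊖ emb z ⊗ θ)
        ≡ emb (ι (ℤ.+ 4) * N (elt x y z)) ⊗ ζinv)
    × (sq (emb (x + P * z) ⊖ emb y ⊗ θ)
        ⊕ sq (emb (x + P * z) ⊖ emb z ⊗ sq θ)
        ⊕ (1K ⊖ emb (ι (ℤ.+ 2) * P) ⊗ sq θinv) ⊗ sq (emb y ⊗ θ ⊖ emb z ⊗ sq θ)
        ≡ emb (ι (ℤ.+ 2) * N (elt x y z)) ⊗ ζinv)
mainTheorem5 p q _ _ x y z _ ζinv ζ⊗ζinv≡1 θinv θ⊗θinv≡1 =
    x⊗y≡z⇒x≡z⊗y⁻¹ (form₁⊗ζ≡4N x y z) ζ⊗ζinv≡1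
  , (begin
      form₂ x y z θinv         ≡⟨ form₂≡form₂′[θ⊗u] x y z θinv ⟩
      form₂′ x y z (θ ⊗ θinv)  ≡⟨ cong (form₂′ x y z) θ⊗θinv≡1 ⟩
      form₂′ x y z 1K          ≡⟨ x⊗y≡z⇒x≡z⊗y⁻¹ (form₂′[1]⊗ζ≡2N x y z) ζ⊗ζinv≡1 ⟩
      emb (ι (ℤ.+ 2) * N (elt x y z)) ⊗ ζinv ∎)
  where
  open Field p q
  open Arithmetic p q
  open ≡-Reasoning
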